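{- Let $G$ be a chordless graph on $n$ vertices whose list chromatic number is $s$. Then for every integer $t$ with $0 < t < s$, $\lambda_t(G) \geq \frac{tn}{s}$.
   Context: A graph is chordless if no cycle in it has a chord (an edge joining two non-consecutive vertices of the cycle). For a graph $G$ and a positive integer $k$, a $k$-assignment is a function assigning to each vertex $v$ a list $l(v)$ of exactly $k$ colours. $G$ is $\mathcal{L}$-list colourable if there is a proper vertex colouring in which each vertex $v$ receives a colour from $l(v)$; $G$ is $k$-choosable if it is $\mathcal{L}$-list colourable for every $k$-assignment $\mathcal{L}$. The list chromatic number $\chi_L(G)$ is the least $k$ such that $G$ is $k$-choosable. For a $t$-assignment $\mathcal{L}_t$, $\lambda_{\mathcal{L}_t}(G)$ is the maximum number of vertices of an induced subgraph of $G$ that is $\mathcal{L}_t$-list colourable, and $\lambda_t(G) = \min\{\lambda_{\mathcal{L}_t}(G) : \mathcal{L}_t \text{ a } t\text{ -assignment for } G\}$. -}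

module Defs where

open import Data.Nat using (ℕ; zero; suc; _+_; _*_; _<_; _≤_; _%_)
open import Data.Nat.DivMod using (m%n<n)
open import Data.Fin using (Fin; toℕ; fromℕ<)
open import Data.Fin.Subset using (Subset; _∈_; ∣_∣)
open import Data.Bool using (Bool; true; false)
open import Data.List using (List; length)
import Data.List.Membership.Propositional as LM
open import Data.List.Relation.Unary.Unique.Propositional using (Unique)
open import Data.Product using (Σ; ∃; _×_)
open import Relation.Binary.PropositionalEquality using (_≡_; _≢_)
open import Relation.Nullary using (¬_)
open import Function.Definitions using (Injective)

record Graph (n : ℕ) : Set where
  field
    adj     : Fin n → Fin n → Bool
    symm    : ∀ u v → adj u v ≡ adj v u
    irrefl  : ∀ v → adj v v ≡ false

open Graph public

Adj : ∀ {n} → Graph n → Fin n → Fin n → Set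
Adj G u v = adj G u v ≡ true

next : ∀ {m} → Fin (suc m) → Fin (suc m)
next {m} i = fromℕ< (m%n<n (suc (toℕ i)) (suc m))

record Cycle {n : ℕ} (G : Graph n) : Set where
  field
    k        : ℕ
    vert     : Fin (suc (suc (suc k))) → Fin n
    distinct : Injective _≡_ _≡_ vert
    edges    : ∀ i → Adj G (vert i) (vert (next i))

open Cycle public

HasChord : ∀ {n} {G : Graph n} → Cycle G → Set
HasChord {G = G} C = Σ _ λ i → Σ _ λ j →
  i ≢ j × j ≢ next i × i ≢ next j × Adj G (vert C i) (vert C j)

Chordless : ∀ {n} → Graph n → Set
Chordless G = (C : Cycle G) → ¬ HasChord C

record Assignment (n k : ℕ) : Set where
  field
    list   : Fin n → List ℕ
    unique : ∀ v → Unique (list v)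
    size   : ∀ v → length (list v) ≡ k

open Assignment public

ListColourableOn : ∀ {n k} → Graph n → Assignment n k → Subset n → Set
ListColourableOn {n} G L S = Σ (Fin n → ℕ) λ c →
    (∀ v → v ∈ S → c v LM.∈ list L v)
  × (∀ u v → u ∈ S → v ∈ S → Adj G u v → c u ≢ c v)

ListColourable : ∀ {n k} → Graph n → Assignment n k → Set
ListColourable {n} G L = Σ (Fin n → ℕ) λ c →
    (∀ v → c v LM.∈ list L v)
  × (∀ u v → Adj G u v → c u ≢ c v)

Choosable : ∀ {n} → Graph n → ℕ → Set
Choosable {n} G k = (L : Assignment n k) → ListColourable G L

ListChromaticNumber : ∀ {n} → Graph n → ℕ → Set
ListChromaticNumber G s =
  0 < s × Choosable G s × (∀ k → 0 < k → k < s → ¬ Choosable G k)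

-- λ_{L}(G) ≥ m : some induced subgraph on at least m vertices is L-list colourable
-- (this is the literal unfolding of "the maximum is ≥ m").
-- λ_t(G) ≥ x (x = a/b rational, b > 0) : for every t-assignment L, λ_L(G) * b ≥ a.
LambdaAtLeast : ∀ {n} → Graph n → (t a b : ℕ) → Set
LambdaAtLeast {n} G t a b = (L : Assignment n t) →
  Σ (Subset n) λ S → ListColourableOn G L S × a ≤ ∣ S ∣ * b

-- Every nonempty induced subgraph G[A] of a chordless graph has a pendant vertex (degree ≤ 1)
-- or two twins v ≠ u of degree ≤ 2 with a common neighbour w.  To find them, grow a path
-- p₀ … pₘ in G[A] at p₀ until p₀ has no neighbour off the path.  If p₁ is its only neighbour,
-- p₀ is pendant.  Otherwise another neighbour pⱼ (j ≥ 2) closes the chordless cycle p₀ … pⱼ,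
-- so all neighbours of p₀ lie in {p₁, pⱼ}.  Reroute the path as pⱼ₋₁ … p₀ pⱼ … pₘ and grow
-- again: either it gets longer, or likewise all neighbours of pⱼ₋₁ lie in {pⱼ₋₂, pⱼ}, and
-- p₀, pⱼ₋₁ are twins around pⱼ.
--
-- Hence G is 2-degenerate and so 3-choosable, i.e. s ≤ 3.  For s = 2, a colouring from the
-- lists {0, 1} bipartitions G, and its larger side is an independent set of at least n/2
-- vertices.  For s = 3 induct on |A|: for t = 1 keep a vertex of degree ≤ 2 and delete its
-- neighbours; for t = 2 delete a pendant vertex, or twins together with their common
-- neighbour, and colour the deleted pendant vertex or twins last, each of them then having at
-- most one coloured neighbour.

module Submission where

open import Defs
open import Data.Nat using (ℕ; zero; suc; _+_; _*_; _∸_; _<_; _≤_; z≤n; s≤s; _%_)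
open import Data.Nat.Properties
open import Data.Nat.Induction using (<-wellFounded)
open import Data.Nat.DivMod using (m<n⇒m%n≡m; n%n≡0; m%n<n)
open import Data.Fin using (Fin; toℕ; fromℕ<) renaming (zero to fzero)
import Data.Fin.Properties as Finₚ
open import Data.Fin.Subset
  using (Subset; _∈_; _∉_; ∣_∣; _─_; _-_; ⁅_⁆; _∪_; _⊆_; ⊤; ∁; inside; outside; Nonempty)
open import Data.Fin.Subset.Properties
  using (x∈p∧x≢y⇒x∈p-y; p─q⊆p; x∈p⇒∣p-x∣<∣p∣; ∣⁅x⁆∣≡1; x∈⁅x⁆; x∈⁅y⁆⇒x≡y;
         x∈p∪q⁺; x∈p∪q⁻; p⊆p∪q; p⊂q⇒∣p∣<∣q∣; nonempty?; _∈?_; ∈⊤; ∣⊤∣≡n; ∣∁p∣≡n∸∣p∣; ∣p∣≤n;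
         x∈∁p⇒x∉p; p⊆q⇒∣p∣≤∣q∣; ⊆-trans)
open import Data.Vec using ([]; _∷_; here; there; tabulate)
open import Data.Vec.Properties using (lookup∘tabulate; []=⇒lookup; lookup⇒[]=)
open import Data.Bool using (true)
import Data.Bool.Properties as Boolₚ
open import Data.List using (List; []; _∷_; length; map; filter)
open import Data.List.Properties using (length-map; filter-notAll)
import Data.List.Membership.Propositional as List
open import Data.List.Membership.Propositional.Properties using (∈-map⁺; ∈-filter⁺)
open import Data.List.Membership.DecPropositional _≟_ using () renaming (_∈?_ to _∈ℕ?_)
open import Data.List.Relation.Unary.Any using (here; there)
import Data.List.Relation.Unary.Any as Any
open import Data.List.Relation.Unary.All using ([]; _∷_; lookup)
open import Data.List.Relation.Unary.AllPairs using ([]; _∷_)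
open import Data.List.Relation.Unary.Unique.Propositional using (Unique)
open import Data.Product using (∃-syntax; _×_; _,_; proj₁; proj₂)
open import Data.Sum using (_⊎_; inj₁; inj₂; [_,_]′)
import Data.Sum as Sum
open import Data.Empty using (⊥-elim)
open import Function using (_∘_)
import Induction.WellFounded as WF
import Relation.Binary.Construct.On as On
open import Relation.Binary.PropositionalEquality
  using (_≡_; _≢_; refl; sym; trans; cong; subst; subst₂; ≢-sym; module ≡-Reasoning)
open import Relation.Nullary using (¬_; yes; no; Dec; contradiction)
open import Relation.Binary using (tri<; tri≈; tri>)
open import Relation.Nullary.Decidable using (_×-dec_; ¬?; decidable-stable; does; dec-true; dec-false)
open import Level using (0ℓ)

Below : {X : Set} → (X → ℕ) → (X → Set) → X → Set
Below f P x = ∀ {y} → f y < f x → P y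

measure-rec : {X : Set} (f : X → ℕ) (P : X → Set) → (∀ x → Below f P x → P x) → ∀ x → P x
measure-rec f P step = WF.All.wfRec (On.wellFounded f <-wellFounded) 0ℓ P step

module _ {n : ℕ} (G : Graph n) where

  Adj-sym : ∀ {u v} → Adj G u v → Adj G v u
  Adj-sym {u} {v} uv = trans (symm G v u) uv

  Adj-irrefl : ∀ {v} → ¬ Adj G v v
  Adj-irrefl {v} vv with trans (sym (irrefl G v)) vv
  ... | ()

  Adj? : ∀ u v → Dec (Adj G u v)
  Adj? u v = adj G u v Boolₚ.≟ true


x∈p─q⇒x∉q : ∀ {n} {p q : Subset n} {x} → x ∈ p ─ q → x ∉ q
x∈p─q⇒x∉q {p = _ ∷ _} {outside ∷ _} here ()
x∈p─q⇒x∉q {p = _ ∷ _} {_ ∷ _} (there x∈p─q) (there x∈q) = x∈p─q⇒x∉q x∈p─q x∈q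

∣p∣≤∣p─q∣+∣q∣ : ∀ {n} (p q : Subset n) → ∣ p ∣ ≤ ∣ p ─ q ∣ + ∣ q ∣
∣p∣≤∣p─q∣+∣q∣ [] [] = z≤n
∣p∣≤∣p─q∣+∣q∣ (inside ∷ p) (inside ∷ q) =
  ≤-trans (s≤s (∣p∣≤∣p─q∣+∣q∣ p q)) (≤-reflexive (sym (+-suc _ _)))
∣p∣≤∣p─q∣+∣q∣ (outside ∷ p) (inside ∷ q) =
  ≤-trans (∣p∣≤∣p─q∣+∣q∣ p q) (+-monoʳ-≤ ∣ p ─ q ∣ (n≤1+n _))
∣p∣≤∣p─q∣+∣q∣ (inside ∷ p) (outside ∷ q) = s≤s (∣p∣≤∣p─q∣+∣q∣ p q)
∣p∣≤∣p─q∣+∣q∣ (outside ∷ p) (outside ∷ q) = ∣p∣≤∣p─q∣+∣q∣ p q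

module _ {n : ℕ} where

  ∣p∣≤1+∣p-x∣ : ∀ (p : Subset n) x → ∣ p ∣ ≤ suc ∣ p - x ∣
  ∣p∣≤1+∣p-x∣ p x = begin
    ∣ p ∣                 ≤⟨ ∣p∣≤∣p─q∣+∣q∣ p ⁅ x ⁆ ⟩
    ∣ p - x ∣ + ∣ ⁅ x ⁆ ∣ ≡⟨ cong (∣ p - x ∣ +_) (∣⁅x⁆∣≡1 x) ⟩
    ∣ p - x ∣ + 1         ≡⟨ +-comm ∣ p - x ∣ 1 ⟩
    suc ∣ p - x ∣         ∎
    where open ≤-Reasoning

  ∣p∣<∣p∪⁅x⁆∣ : ∀ {p : Subset n} {x} → x ∉ p → ∣ p ∣ < ∣ p ∪ ⁅ x ⁆ ∣
  ∣p∣<∣p∪⁅x⁆∣ {p} {x} x∉p = p⊂q⇒∣p∣<∣q∣ (p⊆p∪q ⁅ x ⁆ , x , x∈p∪q⁺ (inj₂ (x∈⁅x⁆ x)) , x∉p)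

  p∪⁅x⁆⊆q : ∀ {p q : Subset n} {x} → p ⊆ q → x ∈ q → p ∪ ⁅ x ⁆ ⊆ q
  p∪⁅x⁆⊆q {p} {q} {x} p⊆q x∈q y∈ with x∈p∪q⁻ p ⁅ x ⁆ y∈
  ... | inj₁ y∈p = p⊆q y∈p
  ... | inj₂ y∈⁅x⁆ = subst (_∈ q) (sym (x∈⁅y⁆⇒x≡y x y∈⁅x⁆)) x∈q

  y∉p∪⁅x⁆ : ∀ {p : Subset n} {x y} → y ∉ p → y ≢ x → y ∉ p ∪ ⁅ x ⁆
  y∉p∪⁅x⁆ {p} {x} y∉p y≢x y∈ with x∈p∪q⁻ p ⁅ x ⁆ y∈
  ... | inj₁ y∈p = y∉p y∈p
  ... | inj₂ y∈⁅x⁆ = y≢x (x∈⁅y⁆⇒x≡y x y∈⁅x⁆)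

  p⊆p-x∪⁅x⁆ : ∀ (p : Subset n) x → p ⊆ (p - x) ∪ ⁅ x ⁆
  p⊆p-x∪⁅x⁆ p x {y} y∈p with y Finₚ.≟ x
  ... | yes refl = x∈p∪q⁺ (inj₂ (x∈⁅x⁆ x))
  ... | no y≢x = x∈p∪q⁺ (inj₁ (x∈p∧x≢y⇒x∈p-y y∈p y≢x))

  infixl 5 _∖_
  _∖_ : Subset n → List (Fin n) → Subset n
  p ∖ [] = p
  p ∖ (x ∷ xs) = (p - x) ∖ xs

  p∖xs⊆p : ∀ (p : Subset n) xs → p ∖ xs ⊆ p
  p∖xs⊆p p [] y∈ = y∈
  p∖xs⊆p p (x ∷ xs) y∈ = p─q⊆p p ⁅ x ⁆ (p∖xs⊆p (p - x) xs y∈)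

  y∈p∖xs⇒y∉xs : ∀ {p : Subset n} {y} xs → y ∈ p ∖ xs → y List.∉ xs
  y∈p∖xs⇒y∉xs {p} (x ∷ xs) y∈ (here refl) = x∈p─q⇒x∉q (p∖xs⊆p (p - x) xs y∈) (x∈⁅x⁆ x)
  y∈p∖xs⇒y∉xs (x ∷ xs) y∈ (there y∈xs) = y∈p∖xs⇒y∉xs xs y∈ y∈xs

  ∣p∣≤∣xs∣+∣p∖xs∣ : ∀ (p : Subset n) xs → ∣ p ∣ ≤ length xs + ∣ p ∖ xs ∣
  ∣p∣≤∣xs∣+∣p∖xs∣ p [] = ≤-refl
  ∣p∣≤∣xs∣+∣p∖xs∣ p (x ∷ xs) = ≤-trans (∣p∣≤1+∣p-x∣ p x) (s≤s (∣p∣≤∣xs∣+∣p∖xs∣ (p - x) xs))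

  ∣p∖x∷xs∣<∣p∣ : ∀ {p : Subset n} {x} xs → x ∈ p → ∣ p ∖ (x ∷ xs) ∣ < ∣ p ∣
  ∣p∖x∷xs∣<∣p∣ {p} {x} xs x∈p =
    ≤-<-trans (p⊆q⇒∣p∣≤∣q∣ (p∖xs⊆p (p - x) xs)) (x∈p⇒∣p-x∣<∣p∣ x∈p)

pigeonhole-∉ : ∀ {xs ys : List ℕ} → Unique ys → length xs < length ys → ∃[ y ] y List.∈ ys × y List.∉ xs
pigeonhole-∉ {xs} {y ∷ ys} (y≢ys ∷ unique-ys) ∣xs∣<∣y∷ys∣ with y ∈ℕ? xs
... | no y∉xs = y , here refl , y∉xs
... | yes y∈xs with pigeonhole-∉ {filter (¬? ∘ (_≟ y)) xs} unique-ys shorter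
  where
  shorter : length (filter (¬? ∘ (_≟ y)) xs) < length ys
  shorter = <-≤-trans (filter-notAll (¬? ∘ (_≟ y)) xs (Any.map (λ { refl ¬y≡y → ¬y≡y refl }) y∈xs))
                      (≤-pred ∣xs∣<∣y∷ys∣)
... | z , z∈ys , z∉ =
  z , there z∈ys , λ z∈xs → z∉ (∈-filter⁺ (¬? ∘ (_≟ y)) z∈xs (≢-sym (lookup y≢ys z∈ys)))

NeighboursIn : ∀ {n} → Graph n → Subset n → Fin n → List (Fin n) → Set
NeighboursIn G S v ns = ∀ {x} → x ∈ S → Adj G v x → x List.∈ ns

Independent : ∀ {n} → Graph n → Subset n → Set
Independent G I = ∀ u v → u ∈ I → v ∈ I → ¬ Adj G u v

module _ {n : ℕ} (G : Graph n) {v : Fin n} where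

  neighboursIn-⊆ : ∀ {S A ns} → S ⊆ A → NeighboursIn G A v ns → NeighboursIn G S v ns
  neighboursIn-⊆ S⊆A nbrs x∈S = nbrs (S⊆A x∈S)

  neighboursIn-∷⁻ : ∀ {S w ns} → w ∉ S → NeighboursIn G S v (w ∷ ns) → NeighboursIn G S v ns
  neighboursIn-∷⁻ w∉S nbrs x∈S vx with nbrs x∈S vx
  ... | here refl = ⊥-elim (w∉S x∈S)
  ... | there x∈ns = x∈ns

module Colouring {n k : ℕ} (G : Graph n) (L : Assignment n k) where

  colourable-⊆ : ∀ {S T} → S ⊆ T → ListColourableOn G L T → ListColourableOn G L S
  colourable-⊆ S⊆T (c , c∈ , proper) =
    c , (λ v v∈S → c∈ v (S⊆T v∈S)) , (λ u v u∈S v∈S → proper u v (S⊆T u∈S) (S⊆T v∈S))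

  colourable-empty : ∀ {S} → ¬ Nonempty S → ListColourableOn G L S
  colourable-empty empty =
    (λ _ → 0) , (λ v v∈S → ⊥-elim (empty (v , v∈S))) , (λ u _ u∈S → ⊥-elim (empty (u , u∈S)))

  colourable-∪⁅⁆ : ∀ {S v ns} → ListColourableOn G L S → NeighboursIn G S v ns → length ns < k →
    ListColourableOn G L (S ∪ ⁅ v ⁆)
  colourable-∪⁅⁆ {S} {v} {ns} (c , c∈ , proper) nbrs ∣ns∣<k = c′ , c′∈ , proper′
    where
    free : ∃[ y ] y List.∈ list L v × y List.∉ map c ns
    free = pigeonhole-∉ (unique L v) (subst₂ _<_ (sym (length-map c ns)) (sym (size L v)) ∣ns∣<k)

    y : ℕ
    y = proj₁ free

    y≢nbr : ∀ {x} → x ∈ S → Adj G v x → y ≢ c x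
    y≢nbr x∈S vx y≡cx =
      proj₂ (proj₂ free) (subst (List._∈ map c ns) (sym y≡cx) (∈-map⁺ c (nbrs x∈S vx)))

    old : ∀ {x} → x ∈ S ∪ ⁅ v ⁆ → x ≢ v → x ∈ S
    old {x} x∈ x≢v with x∈p∪q⁻ S ⁅ v ⁆ x∈
    ... | inj₁ x∈S = x∈S
    ... | inj₂ x∈⁅v⁆ = ⊥-elim (x≢v (x∈⁅y⁆⇒x≡y v x∈⁅v⁆))

    c′ : Fin n → ℕ
    c′ x with x Finₚ.≟ v
    ... | yes _ = y
    ... | no _ = c x

    c′∈ : ∀ x → x ∈ S ∪ ⁅ v ⁆ → c′ x List.∈ list L x
    c′∈ x x∈ with x Finₚ.≟ v
    ... | yes refl = proj₁ (proj₂ free)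
    ... | no x≢v = c∈ x (old x∈ x≢v)

    proper′ : ∀ x z → x ∈ S ∪ ⁅ v ⁆ → z ∈ S ∪ ⁅ v ⁆ → Adj G x z → c′ x ≢ c′ z
    proper′ x z x∈ z∈ xz with x Finₚ.≟ v | z Finₚ.≟ v
    ... | yes refl | yes refl = ⊥-elim (Adj-irrefl G xz)
    ... | yes refl | no z≢v = y≢nbr (old z∈ z≢v) xz
    ... | no x≢v | yes refl = y≢nbr (old x∈ x≢v) (Adj-sym G xz) ∘ sym
    ... | no x≢v | no z≢v = proper x z (old x∈ x≢v) (old z∈ z≢v) xz

independent-colourable : ∀ {n k} (G : Graph n) (L : Assignment n (suc k)) {I} → Independent G I →
  ListColourableOn G L I
independent-colourable G L independent =
  (λ v → proj₁ (someColour v)) , (λ v _ → proj₁ (proj₂ (someColour v))) ,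
  (λ u v u∈I v∈I uv _ → independent u v u∈I v∈I uv)
  where
  someColour : ∀ v → ∃[ y ] y List.∈ list L v × y List.∉ []
  someColour v = pigeonhole-∉ (unique L v) (subst (0 <_) (sym (size L v)) (s≤s z≤n))

data Reducible {n : ℕ} (G : Graph n) (A : Subset n) : Set where
  pendant : ∀ {v} a → v ∈ A → NeighboursIn G A v (a ∷ []) → Reducible G A
  twins   : ∀ {v u} w a b → v ∈ A → u ∈ A → v ≢ u → v ≢ w →
            NeighboursIn G A v (w ∷ a ∷ []) → NeighboursIn G A u (w ∷ b ∷ []) → Reducible G A

-- Only the values of vertex at 0, …, len matter.
record Path {n : ℕ} (G : Graph n) (A : Subset n) : Set where
  field
    len              : ℕ
    vertex           : ℕ → Fin n
    vertex-injective : ∀ {i j} → i ≤ len → j ≤ len → vertex i ≡ vertex j → i ≡ j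
    vertex-adj       : ∀ {i} → i < len → Adj G (vertex i) (vertex (suc i))
    vertex-∈         : ∀ {i} → i ≤ len → vertex i ∈ A

open Path

toℕ-next : ∀ {m} (f : Fin (suc m)) → suc (toℕ f) < suc m → toℕ (next f) ≡ suc (toℕ f)
toℕ-next {m} f lt = trans (Finₚ.toℕ-fromℕ< (m%n<n (suc (toℕ f)) (suc m))) (m<n⇒m%n≡m lt)

toℕ-next-last : ∀ {m} (f : Fin (suc m)) → toℕ f ≡ m → toℕ (next f) ≡ 0
toℕ-next-last {m} f f≡m = trans (Finₚ.toℕ-fromℕ< (m%n<n (suc (toℕ f)) (suc m)))
  (trans (cong (λ i → suc i % suc m) f≡m) (n%n≡0 (suc m)))

reverseUpTo : ℕ → ℕ → ℕ
reverseUpTo i k with k ≤? i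
... | yes _ = i ∸ k
... | no _ = k

reverseUpTo-≤ : ∀ {i k} → k ≤ i → reverseUpTo i k ≡ i ∸ k
reverseUpTo-≤ {i} {k} k≤i with k ≤? i
... | yes _ = refl
... | no k≰i = contradiction k≤i k≰i

reverseUpTo-> : ∀ {i k} → i < k → reverseUpTo i k ≡ k
reverseUpTo-> {i} {k} i<k with k ≤? i
... | yes k≤i = contradiction k≤i (<⇒≱ i<k)
... | no _ = refl

reverseUpTo-involutive : ∀ i k → reverseUpTo i (reverseUpTo i k) ≡ k
reverseUpTo-involutive i k with k ≤? i
... | yes k≤i = trans (reverseUpTo-≤ (m∸n≤m i k)) (m∸[m∸n]≡n k≤i)
... | no k≰i = reverseUpTo-> (≰⇒> k≰i)

reverseUpTo-bounded : ∀ {i k m} → i ≤ m → k ≤ m → reverseUpTo i k ≤ m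
reverseUpTo-bounded {i} {k} i≤m k≤m with k ≤? i
... | yes _ = ≤-trans (m∸n≤m i k) i≤m
... | no _ = k≤m

module _ {n : ℕ} {G : Graph n} {A : Subset n} where

  OnPath : Path G A → Fin n → Set
  OnPath P x = ∃[ i ] i < suc (len P) × vertex P i ≡ x

  onPath? : ∀ P x → Dec (OnPath P x)
  onPath? P x = anyUpTo? (λ i → vertex P i Finₚ.≟ x) (suc (len P))

  Stuck : Path G A → Set
  Stuck P = ∀ {x} → x ∈ A → Adj G (vertex P 0) x → OnPath P x

  len<n : (P : Path G A) → len P < n
  len<n P with len P <? n
  ... | yes len<n = len<n
  ... | no len≮n with Finₚ.pigeonhole (s≤s (≮⇒≥ len≮n)) (vertex P ∘ toℕ)
  ... | i , j , i<j , same =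
    contradiction (vertex-injective P (bound i) (bound j) same) (<⇒≢ i<j)
    where
    bound : (f : Fin (suc (len P))) → toℕ f ≤ len P
    bound f = ≤-pred (Finₚ.toℕ<n f)

  singleton : ∀ {x} → x ∈ A → Path G A
  singleton {x} x∈A = record
    { len = 0
    ; vertex = λ _ → x
    ; vertex-injective = λ i≤0 j≤0 _ → trans (n≤0⇒n≡0 i≤0) (sym (n≤0⇒n≡0 j≤0))
    ; vertex-adj = λ ()
    ; vertex-∈ = λ _ → x∈A
    }

  prepend : (P : Path G A) {x : Fin n} → x ∈ A → Adj G (vertex P 0) x → ¬ OnPath P x → Path G A
  prepend P {x} x∈A adj off = record
    { len = suc (len P)
    ; vertex = vertex′
    ; vertex-injective = injective
    ; vertex-adj = λ { {zero} _ → Adj-sym G adj ; {suc i} i<len → vertex-adj P (≤-pred i<len) }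
    ; vertex-∈ = λ { {zero} _ → x∈A ; {suc i} i≤len → vertex-∈ P (≤-pred i≤len) }
    }
    where
    vertex′ : ℕ → Fin n
    vertex′ zero = x
    vertex′ (suc i) = vertex P i

    injective : ∀ {i j} → i ≤ suc (len P) → j ≤ suc (len P) → vertex′ i ≡ vertex′ j → i ≡ j
    injective {zero} {zero} _ _ _ = refl
    injective {zero} {suc j} _ j≤ x≡ = contradiction (j , j≤ , sym x≡) off
    injective {suc i} {zero} i≤ _ ≡x = contradiction (i , i≤ , ≡x) off
    injective {suc i} {suc j} i≤ j≤ same = cong suc (vertex-injective P (≤-pred i≤) (≤-pred j≤) same)

  extend-or-stuck : (P : Path G A) → (∃[ Q ] len P < len Q) ⊎ Stuck P
  extend-or-stuck P with Finₚ.any? (λ x → (x ∈? A) ×-dec (Adj? G (vertex P 0) x ×-dec ¬? (onPath? P x)))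
  ... | yes (x , x∈A , adj , off) = inj₁ (prepend P x∈A adj off , ≤-refl)
  ... | no none = inj₂ λ {x} x∈A adj →
    decidable-stable (onPath? P x) (λ off → none (x , x∈A , adj , off))

  closingCycle : (P : Path G A) → ∀ k → suc (suc k) ≤ len P →
    Adj G (vertex P 0) (vertex P (suc (suc k))) → Cycle G
  closingCycle P k j≤len closing = record
    { k = k
    ; vert = vertex P ∘ toℕ
    ; distinct = λ {f} {g} same → Finₚ.toℕ-injective (vertex-injective P (bound f) (bound g) same)
    ; edges = edge
    }
    where
    bound : (f : Fin (suc (suc (suc k)))) → toℕ f ≤ len P
    bound f = ≤-trans (≤-pred (Finₚ.toℕ<n f)) j≤len

    edge : ∀ f → Adj G (vertex P (toℕ f)) (vertex P (toℕ (next f)))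
    edge f with suc (toℕ f) <? suc (suc (suc k))
    ... | yes lt = subst (λ i → Adj G (vertex P (toℕ f)) (vertex P i)) (sym (toℕ-next f lt))
                         (vertex-adj P (≤-trans (≤-pred lt) j≤len))
    ... | no ≮ = subst₂ (λ i j → Adj G (vertex P i) (vertex P j)) (sym last) (sym (toℕ-next-last f last))
                        (Adj-sym G closing)
      where
      last : toℕ f ≡ suc (suc k)
      last = ≤-antisym (≤-pred (Finₚ.toℕ<n f)) (≤-pred (≮⇒≥ ≮))

  -- p₀ … pⱼ closes into a cycle, of which p₀pᵢ would be a chord.
  no-shortcut : Chordless G → (P : Path G A) → ∀ {i j} → 2 ≤ i → i < j → j ≤ len P →
    Adj G (vertex P 0) (vertex P j) → ¬ Adj G (vertex P 0) (vertex P i)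
  no-shortcut _ _ {j = suc zero} (s≤s (s≤s _)) (s≤s ()) _ _
  no-shortcut chordless P {i} {suc (suc k)} 2≤i i<j j≤len closing shortcut =
    chordless (closingCycle P k j≤len closing) (fzero , i′ , 0≢i′ , i′≢1 , 0≢i′+1 , chord)
    where
    i<k+3 : i < suc (suc (suc k))
    i<k+3 = m≤n⇒m≤1+n i<j
    i′ : Fin (suc (suc (suc k)))
    i′ = fromℕ< i<k+3
    toℕ-i′ : toℕ i′ ≡ i
    toℕ-i′ = Finₚ.toℕ-fromℕ< i<k+3
    0≢i′ : fzero ≢ i′
    0≢i′ 0≡i′ = <⇒≢ (≤-trans (s≤s z≤n) 2≤i) (trans (cong toℕ 0≡i′) toℕ-i′)
    i′≢1 : i′ ≢ next fzero
    i′≢1 i′≡1 = <⇒≢ 2≤i (begin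
      1                              ≡⟨ toℕ-next {suc (suc k)} fzero (s≤s (s≤s z≤n)) ⟨
      toℕ (next {suc (suc k)} fzero) ≡⟨ cong toℕ i′≡1 ⟨
      toℕ i′                         ≡⟨ toℕ-i′ ⟩
      i                              ∎)
      where open ≡-Reasoning
    0≢i′+1 : fzero ≢ next i′
    0≢i′+1 0≡ = 0≢1+n (begin
      0             ≡⟨ cong toℕ 0≡ ⟩
      toℕ (next i′) ≡⟨ toℕ-next i′ (subst (λ m → suc m < suc (suc (suc k))) (sym toℕ-i′) (s≤s i<j)) ⟩
      suc (toℕ i′)  ≡⟨ cong suc toℕ-i′ ⟩
      suc i         ∎)
      where open ≡-Reasoning
    chord : Adj G (vertex P 0) (vertex P (toℕ i′))
    chord = subst (λ m → Adj G (vertex P 0) (vertex P m)) (sym toℕ-i′) shortcut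

  stuck-neighbours : Chordless G → (P : Path G A) → Stuck P → ∀ {j} → 2 ≤ j → j ≤ len P →
    Adj G (vertex P 0) (vertex P j) → NeighboursIn G A (vertex P 0) (vertex P j ∷ vertex P 1 ∷ [])
  stuck-neighbours chordless P stuck {j} 2≤j j≤len closing x∈A adj with stuck x∈A adj
  ... | zero , _ , refl = ⊥-elim (Adj-irrefl G adj)
  ... | suc zero , _ , refl = there (here refl)
  ... | suc (suc i) , i<len+1 , refl with <-cmp (suc (suc i)) j
  ... | tri< i<j _ _ = ⊥-elim (no-shortcut chordless P (s≤s (s≤s z≤n)) i<j j≤len closing adj)
  ... | tri≈ _ refl _ = here refl
  ... | tri> _ _ j<i = ⊥-elim (no-shortcut chordless P 2≤j j<i (≤-pred i<len+1) adj closing)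

  -- For p₀ adjacent to pᵢ₊₁ this is the path pᵢ, …, p₀, pᵢ₊₁, …, p_len.
  reversePrefix : (P : Path G A) → ∀ i → suc i ≤ len P →
    Adj G (vertex P 0) (vertex P (suc i)) → Path G A
  reversePrefix P i i<len closing = record
    { len = len P
    ; vertex = vertex P ∘ reverseUpTo i
    ; vertex-injective = injective
    ; vertex-adj = edge
    ; vertex-∈ = λ k≤len → vertex-∈ P (reverseUpTo-bounded i≤len k≤len)
    }
    where
    i≤len : i ≤ len P
    i≤len = <⇒≤ i<len

    injective : ∀ {k l} → k ≤ len P → l ≤ len P →
      vertex P (reverseUpTo i k) ≡ vertex P (reverseUpTo i l) → k ≡ l
    injective {k} {l} k≤len l≤len same = begin
      k                               ≡⟨ reverseUpTo-involutive i k ⟨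
      reverseUpTo i (reverseUpTo i k) ≡⟨ cong (reverseUpTo i) same′ ⟩
      reverseUpTo i (reverseUpTo i l) ≡⟨ reverseUpTo-involutive i l ⟩
      l                               ∎
      where
      open ≡-Reasoning
      same′ : reverseUpTo i k ≡ reverseUpTo i l
      same′ = vertex-injective P (reverseUpTo-bounded i≤len k≤len) (reverseUpTo-bounded i≤len l≤len) same

    Edge : ℕ → ℕ → Set
    Edge a b = Adj G (vertex P a) (vertex P b)

    edge : ∀ {k} → k < len P → Edge (reverseUpTo i k) (reverseUpTo i (suc k))
    edge {k} k<len with <-cmp k i
    ... | tri< k<i _ _ =
      subst₂ Edge (sym (trans (reverseUpTo-≤ (<⇒≤ k<i)) i∸k≡1+i∸[1+k])) (sym (reverseUpTo-≤ k<i))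
        (Adj-sym G (vertex-adj P (≤-trans (≤-reflexive (sym i∸k≡1+i∸[1+k])) (≤-trans (m∸n≤m i k) i≤len))))
      where
      i∸k≡1+i∸[1+k] : i ∸ k ≡ suc (i ∸ suc k)
      i∸k≡1+i∸[1+k] = +-∸-assoc 1 k<i
    ... | tri≈ _ refl _ =
      subst₂ Edge (sym (trans (reverseUpTo-≤ {k} ≤-refl) (n∸n≡0 k))) (sym (reverseUpTo-> (n<1+n k))) closing
    ... | tri> _ _ i<k =
      subst₂ Edge (sym (reverseUpTo-> i<k)) (sym (reverseUpTo-> (m<n⇒m<1+n i<k))) (vertex-adj P k<len)

  -- Unless the rerouted path pᵢ₊₁, …, p₀, pᵢ₊₂, … grows, p₀ and pᵢ₊₁ are twins around pᵢ₊₂.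
  twins-or-longer : Chordless G → (P : Path G A) → Stuck P → ∀ {i} → suc (suc i) ≤ len P →
    Adj G (vertex P 0) (vertex P (suc (suc i))) → Reducible G A ⊎ ∃[ Q ] len P < len Q
  twins-or-longer chordless P stuck {i} j≤len closing
    with extend-or-stuck (reversePrefix P (suc i) j≤len closing)
  ... | inj₁ longer = inj₂ longer
  ... | inj₂ stuck′ = inj₁ (twins (vertex P j) (vertex P 1) (vertex P′ 1)
                          (vertex-∈ P z≤n) (vertex-∈ P′ z≤n) v≢u v≢w
                          (stuck-neighbours chordless P stuck 2≤j j≤len closing) nbrs-u)
    where
    j : ℕ
    j = suc (suc i)
    2≤j : 2 ≤ j
    2≤j = s≤s (s≤s z≤n)
    P′ : Path G A
    P′ = reversePrefix P (suc i) j≤len closing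
    start′ : vertex P′ 0 ≡ vertex P (suc i)
    start′ = cong (vertex P) (reverseUpTo-≤ z≤n)
    w′ : vertex P′ j ≡ vertex P j
    w′ = cong (vertex P) (reverseUpTo-> ≤-refl)
    nbrs-u : NeighboursIn G A (vertex P′ 0) (vertex P j ∷ vertex P′ 1 ∷ [])
    nbrs-u = subst (λ w → NeighboursIn G A (vertex P′ 0) (w ∷ vertex P′ 1 ∷ [])) w′
      (stuck-neighbours chordless P′ stuck′ 2≤j j≤len closing′)
      where
      closing′ : Adj G (vertex P′ 0) (vertex P′ j)
      closing′ = subst₂ (Adj G) (sym start′) (sym w′) (vertex-adj P j≤len)
    v≢u : vertex P 0 ≢ vertex P′ 0
    v≢u same = 0≢1+n (vertex-injective P z≤n (≤-trans (n≤1+n _) j≤len) (trans same start′))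
    v≢w : vertex P 0 ≢ vertex P j
    v≢w same = 0≢1+n (vertex-injective P z≤n j≤len same)

  reducible-or-longer : Chordless G → (P : Path G A) → Reducible G A ⊎ ∃[ Q ] len P < len Q
  reducible-or-longer chordless P with extend-or-stuck P
  ... | inj₁ longer = inj₂ longer
  ... | inj₂ stuck
    with Finₚ.any? (λ x → (x ∈? A) ×-dec (Adj? G (vertex P 0) x ×-dec ¬? (x Finₚ.≟ vertex P 1)))
  ...   | no none = inj₁ (pendant (vertex P 1) (vertex-∈ P z≤n) λ {x} x∈A adj →
            here (decidable-stable (x Finₚ.≟ vertex P 1) (λ x≢v₁ → none (x , x∈A , adj , x≢v₁))))
  ...   | yes (x , x∈A , adj , x≢v₁) with stuck x∈A adj
  ...     | zero , _ , refl = ⊥-elim (Adj-irrefl G adj)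
  ...     | suc zero , _ , refl = ⊥-elim (x≢v₁ refl)
  ...     | suc (suc i) , j<len+1 , refl = twins-or-longer chordless P stuck (≤-pred j<len+1) adj

  reducible : Chordless G → Nonempty A → Reducible G A
  reducible chordless (x , x∈A) = measure-rec remaining (λ _ → Reducible G A) search (singleton x∈A)
    where
    remaining : Path G A → ℕ
    remaining P = n ∸ len P
    search : ∀ P → Below remaining (λ _ → Reducible G A) P → Reducible G A
    search P longer-reducible with reducible-or-longer chordless P
    ... | inj₁ r = r
    ... | inj₂ (Q , longer) = longer-reducible {Q} (∸-monoʳ-< longer (<⇒≤ (len<n Q)))

low-degree-vertex : ∀ {n} {G : Graph n} {A} → Reducible G A →
  ∃[ v ] ∃[ a ] ∃[ b ] v ∈ A × NeighboursIn G A v (a ∷ b ∷ [])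
low-degree-vertex (pendant a v∈A nbrs) = _ , a , a , v∈A , λ x∈A vx → there (nbrs x∈A vx)
low-degree-vertex (twins w a _ v∈A _ _ _ nbrs _) = _ , w , a , v∈A , nbrs

choosable-3 : ∀ {n} {G : Graph n} → Chordless G → Choosable G 3
choosable-3 {n} {G} chordless L with measure-rec ∣_∣ (ListColourableOn G L) step ⊤
  where
  open Colouring G L
  step : ∀ A → Below ∣_∣ (ListColourableOn G L) A → ListColourableOn G L A
  step A rec with nonempty? A
  ... | no empty = colourable-empty empty
  ... | yes nonempty with low-degree-vertex (reducible chordless nonempty)
  ... | v , _ , _ , v∈A , nbrs = colourable-⊆ (p⊆p-x∪⁅x⁆ A v)
    (colourable-∪⁅⁆ (rec (x∈p⇒∣p-x∣<∣p∣ v∈A)) (neighboursIn-⊆ G (p─q⊆p A ⁅ v ⁆) nbrs) ≤-refl)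
... | c , c∈ , proper = c , (λ v → c∈ v ∈⊤) , (λ u v → proper u v ∈⊤ ∈⊤)

ColourableFraction : ∀ {n k} → Graph n → Assignment n k → ℕ → ℕ → Subset n → Set
ColourableFraction G L t s A = ∃[ S ] S ⊆ A × ListColourableOn G L S × t * ∣ A ∣ ≤ s * ∣ S ∣

ratio-≤-+ : ∀ {t s} d e {a a′ b b′} →
  a ≤ d + a′ → t * a′ ≤ s * b′ → e + b′ ≤ b → t * d ≤ s * e → t * a ≤ s * b
ratio-≤-+ {t} {s} d e {a} {a′} {b} {b′} a≤d+a′ ta′≤sb′ e+b′≤b td≤se = begin
  t * a         ≤⟨ *-monoʳ-≤ t a≤d+a′ ⟩
  t * (d + a′)   ≡⟨ *-distribˡ-+ t d a′ ⟩
  t * d + t * a′ ≤⟨ +-mono-≤ td≤se ta′≤sb′ ⟩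
  s * e + s * b′ ≡⟨ *-distribˡ-+ s e b′ ⟨
  s * (e + b′)   ≤⟨ *-monoʳ-≤ s e+b′≤b ⟩
  s * b         ∎
  where open ≤-Reasoning

fraction-rec : ∀ {n k} (G : Graph n) (L : Assignment n k) t s → t ≤ s →
  (∀ A → Nonempty A → Below ∣_∣ (ColourableFraction G L t s) A → ColourableFraction G L t s A) →
  ∀ A → ColourableFraction G L t s A
fraction-rec G L t s t≤s step = measure-rec ∣_∣ (ColourableFraction G L t s) step′
  where
  open Colouring G L
  step′ : ∀ A → Below ∣_∣ (ColourableFraction G L t s) A → ColourableFraction G L t s A
  step′ A rec with nonempty? A
  ... | no empty = A , (λ x∈A → x∈A) , colourable-empty empty , *-monoˡ-≤ ∣ A ∣ t≤s
  ... | yes nonempty = step A nonempty rec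

lambda-from-fraction : ∀ {n} (G : Graph n) {t s} →
  (∀ L → ColourableFraction G L t s ⊤) → LambdaAtLeast G t (t * n) s
lambda-from-fraction {n} G {t} {s} fraction L with fraction L
... | S , _ , colourable , bound =
  S , colourable , subst₂ _≤_ (cong (t *_) (∣⊤∣≡n n)) (*-comm s ∣ S ∣) bound

removed-∉ : ∀ {n} {S : Subset n} A xs {x} → S ⊆ A ∖ xs → x List.∈ xs → x ∉ S
removed-∉ A xs S⊆A∖xs x∈xs x∈S = y∈p∖xs⇒y∉xs xs (S⊆A∖xs x∈S) x∈xs

module _ {n : ℕ} {G : Graph n} (chordless : Chordless G) where

  colourable-third : (L : Assignment n 1) → ∀ A → ColourableFraction G L 1 3 A
  colourable-third L = fraction-rec G L 1 3 (s≤s z≤n) step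
    where
    open Colouring G L
    step : ∀ A → Nonempty A → Below ∣_∣ (ColourableFraction G L 1 3) A → ColourableFraction G L 1 3 A
    step A nonempty rec with low-degree-vertex (reducible chordless nonempty)
    ... | v , a , b , v∈A , nbrs with rec (∣p∖x∷xs∣<∣p∣ (a ∷ b ∷ []) v∈A)
    ... | S , S⊆ , colourable , bound =
      S ∪ ⁅ v ⁆ , p∪⁅x⁆⊆q S⊆A v∈A , colourable-∪⁅⁆ colourable isolated (s≤s z≤n) ,
      ratio-≤-+ {1} {3} 3 1 (∣p∣≤∣xs∣+∣p∖xs∣ A (v ∷ a ∷ b ∷ [])) bound
        (∣p∣<∣p∪⁅x⁆∣ (removed (here refl))) ≤-refl
      where
      S⊆A : S ⊆ A
      S⊆A = ⊆-trans S⊆ (p∖xs⊆p A (v ∷ a ∷ b ∷ []))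
      removed : ∀ {x} → x List.∈ v ∷ a ∷ b ∷ [] → x ∉ S
      removed = removed-∉ A (v ∷ a ∷ b ∷ []) S⊆
      isolated : NeighboursIn G S v []
      isolated = neighboursIn-∷⁻ G (removed (there (there (here refl))))
                   (neighboursIn-∷⁻ G (removed (there (here refl))) (neighboursIn-⊆ G S⊆A nbrs))

  colourable-two-thirds : (L : Assignment n 2) → ∀ A → ColourableFraction G L 2 3 A
  colourable-two-thirds L = fraction-rec G L 2 3 (n≤1+n 2) step
    where
    open Colouring G L
    step : ∀ A → Nonempty A → Below ∣_∣ (ColourableFraction G L 2 3) A → ColourableFraction G L 2 3 A
    step A nonempty rec with reducible chordless nonempty
    ... | pendant {v} a v∈A nbrs with rec (∣p∖x∷xs∣<∣p∣ [] v∈A)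
    ...   | S , S⊆ , colourable , bound =
      S ∪ ⁅ v ⁆ , p∪⁅x⁆⊆q S⊆A v∈A , colourable-∪⁅⁆ colourable (neighboursIn-⊆ G S⊆A nbrs) ≤-refl ,
      ratio-≤-+ {2} {3} 1 1 (∣p∣≤∣xs∣+∣p∖xs∣ A (v ∷ [])) bound
        (∣p∣<∣p∪⁅x⁆∣ (removed (here refl))) (n≤1+n 2)
      where
      S⊆A : S ⊆ A
      S⊆A = ⊆-trans S⊆ (p∖xs⊆p A (v ∷ []))
      removed : ∀ {x} → x List.∈ v ∷ [] → x ∉ S
      removed = removed-∉ A (v ∷ []) S⊆
    step A nonempty rec
        | twins {v} {u} w a b v∈A u∈A v≢u v≢w nbrs-v nbrs-u with rec (∣p∖x∷xs∣<∣p∣ (w ∷ u ∷ []) v∈A)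
    ...   | S , S⊆ , colourable , bound =
      S₂ , p∪⁅x⁆⊆q S₁⊆A u∈A ,
      colourable-∪⁅⁆ colourable₁ (neighboursIn-∷⁻ G w∉S₁ (neighboursIn-⊆ G S₁⊆A nbrs-u)) ≤-refl ,
      ratio-≤-+ {2} {3} 3 2 (∣p∣≤∣xs∣+∣p∖xs∣ A (v ∷ w ∷ u ∷ [])) bound
        (≤-trans (s≤s (∣p∣<∣p∪⁅x⁆∣ (removed (here refl))))
                 (∣p∣<∣p∪⁅x⁆∣ (y∉p∪⁅x⁆ (removed (there (there (here refl)))) (≢-sym v≢u))))
        ≤-refl
      where
      S₁ S₂ : Subset n
      S₁ = S ∪ ⁅ v ⁆
      S₂ = S₁ ∪ ⁅ u ⁆
      S⊆A : S ⊆ A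
      S⊆A = ⊆-trans S⊆ (p∖xs⊆p A (v ∷ w ∷ u ∷ []))
      removed : ∀ {x} → x List.∈ v ∷ w ∷ u ∷ [] → x ∉ S
      removed = removed-∉ A (v ∷ w ∷ u ∷ []) S⊆
      S₁⊆A : S₁ ⊆ A
      S₁⊆A = p∪⁅x⁆⊆q S⊆A v∈A
      w∉S₁ : w ∉ S₁
      w∉S₁ = y∉p∪⁅x⁆ (removed (there (here refl))) (≢-sym v≢w)
      colourable₁ : ListColourableOn G L S₁
      colourable₁ = colourable-∪⁅⁆ colourable
        (neighboursIn-∷⁻ G (removed (there (here refl))) (neighboursIn-⊆ G S⊆A nbrs-v)) ≤-refl

colourClass : ∀ {n} → (Fin n → ℕ) → ℕ → Subset n
colourClass c y = tabulate (λ v → does (c v ≟ y))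

module _ {n : ℕ} (c : Fin n → ℕ) (y : ℕ) where

  ∈-colourClass : ∀ {x} → x ∈ colourClass c y → c x ≡ y
  ∈-colourClass {x} x∈ = decidable-stable (c x ≟ y) λ cx≢y →
    contradiction (trans (sym (dec-false (c x ≟ y) cx≢y)) marked) λ ()
    where
    marked : does (c x ≟ y) ≡ true
    marked = trans (sym (lookup∘tabulate (λ v → does (c v ≟ y)) x)) ([]=⇒lookup x∈)

  ∉-colourClass : ∀ {x} → x ∉ colourClass c y → c x ≢ y
  ∉-colourClass {x} x∉ cx≡y = x∉ (lookup⇒[]= x (colourClass c y)
    (trans (lookup∘tabulate (λ v → does (c v ≟ y)) x) (dec-true (c x ≟ y) cx≡y)))

larger-half : ∀ a b {m} → a + b ≡ m → m ≤ a * 2 ⊎ m ≤ b * 2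
larger-half a b refl = Sum.map (λ b≤a → ≤-trans (+-monoʳ-≤ a b≤a) (≤-reflexive (x+x≡x*2 a)))
                               (λ a≤b → ≤-trans (+-monoˡ-≤ b a≤b) (≤-reflexive (x+x≡x*2 b)))
                               (≤-total b a)
  where
  x+x≡x*2 : ∀ x → x + x ≡ x * 2
  x+x≡x*2 x = trans (cong (x +_) (sym (+-identityʳ x))) (*-comm 2 x)

twoColours : ∀ {n} → Assignment n 2
twoColours = record
  { list = λ _ → 0 ∷ 1 ∷ []
  ; unique = λ _ → ((λ ()) ∷ []) ∷ [] ∷ []
  ; size = λ _ → refl
  }

independent-half : ∀ {n} (G : Graph n) → ListColourable G twoColours →
  ∃[ I ] Independent G I × n ≤ ∣ I ∣ * 2
independent-half {n} G (c , c∈ , proper) =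
  [ (λ bound → I₀ , zeros , bound) , (λ bound → ∁ I₀ , ones , bound) ]′
    (larger-half ∣ I₀ ∣ ∣ ∁ I₀ ∣ sizes)
  where
  I₀ : Subset n
  I₀ = colourClass c 0
  sizes : ∣ I₀ ∣ + ∣ ∁ I₀ ∣ ≡ n
  sizes = trans (cong (∣ I₀ ∣ +_) (∣∁p∣≡n∸∣p∣ I₀)) (m+[n∸m]≡n (∣p∣≤n I₀))
  zeros : Independent G I₀
  zeros u v u∈ v∈ uv = proper u v uv (trans (∈-colourClass c 0 u∈) (sym (∈-colourClass c 0 v∈)))
  one : ∀ {x} → x ∈ ∁ I₀ → c x ≡ 1
  one {x} x∈ with c∈ x
  ... | here c≡0 = contradiction c≡0 (∉-colourClass c 0 (x∈∁p⇒x∉p x∈))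
  ... | there (here c≡1) = c≡1
  ones : Independent G (∁ I₀)
  ones u v u∈ v∈ uv = proper u v uv (trans (one u∈) (sym (one v∈)))

lambda-from-half : ∀ {n} (G : Graph n) →
  (∃[ I ] Independent G I × n ≤ ∣ I ∣ * 2) → LambdaAtLeast G 1 (1 * n) 2
lambda-from-half {n} G (I , independent , bound) L =
  I , independent-colourable G L independent , subst (_≤ ∣ I ∣ * 2) (sym (*-identityˡ n)) bound

mainTheorem5 : ∀ (n : ℕ) (G : Graph n) (s : ℕ) → Chordless G → ListChromaticNumber G s →
    ∀ (t : ℕ) → 0 < t → t < s → LambdaAtLeast G t (t * n) s
mainTheorem5 n G s chordless (_ , choosable , minimal) t 0<t t<s = cases s t 0<t t<s s≤3 choosable
  where
  s≤3 : s ≤ 3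
  s≤3 = ≮⇒≥ λ 3<s → minimal 3 (s≤s z≤n) 3<s (choosable-3 chordless)

  cases : ∀ s t → 0 < t → t < s → s ≤ 3 → Choosable G s → LambdaAtLeast G t (t * n) s
  cases 2 1 _ _ _ choosable-2 = lambda-from-half G (independent-half G (choosable-2 twoColours))
  cases 3 1 _ _ _ _ = lambda-from-fraction G (λ L → colourable-third chordless L ⊤)
  cases 3 2 _ _ _ _ = lambda-from-fraction G (λ L → colourable-two-thirds chordless L ⊤)
  cases _ 0 () _ _ _
  cases 1 (suc _) _ (s≤s ()) _ _
  cases 2 (suc (suc _)) _ (s≤s (s≤s ())) _ _
  cases 3 (suc (suc (suc _))) _ (s≤s (s≤s (s≤s ()))) _ _
  cases (suc (suc (suc (suc _)))) _ _ _ (s≤s (s≤s (s≤s ()))) _
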